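{- Let $F$ be either the hyperspace functor $\mathrm{Exp}$ or the symmetric power functor $\mathrm{SP}^n$ for some $n\ge 2$, as functors on finite sets. Then there exist finite sets $a_0,a_1,a_2$ such that the commutative $3$-cube $$\Big(F\big(\pi^{b(s)}_{b(t)}\colon 2^{b(s)}\to 2^{b(t)}\big)\ :\ s\subseteq t\subseteq 3\Big)$$ is not $3$-commutative, where $b(\emptyset)=a_0\cup a_1\cup a_2$, $b(s)=\bigcap_{i\in s}a_i$ for nonempty $s\subseteq 3=\{0,1,2\}$, and $\pi^p_q\colon 2^p\to 2^q$ is the restriction map $(x_i)_{i\in p}\mapsto(x_i)_{i\in q}$ for $q\subseteq p$.
   Context: For a finite set $X$, $\mathrm{Exp}(X)$ is the set of nonempty subsets of $X$ (the Vietoris hyperspace of the discrete space $X$), and for $f\colon X\to Y$, $\mathrm{Exp}(f)(K)=f[K]$. $\mathrm{SP}^n(X)=X^n/\mathrm{Sym}(n)$ is the quotient of $X^n$ by the action of the symmetric group permuting coordinates, and $\mathrm{SP}^n(f)((x_i)_{i<n}/\mathrm{Sym}(n))=(f(x_i))_{i<n}/\mathrm{Sym}(n)$. For a finite set $p$, $2^p$ is the set of functions $p\to\{0,1\}$. A commutative $3$-cube of sets is a family of maps $f^s_t\colon X_s\to X_t$ for $s\subseteq t\subseteq 3$ forming a functor from $(\mathcal{P}(3),\subseteq)$. It is $3$-commutative if for every $(p_0,p_1,p_2)\in\prod_{i<3}X_{\{i\}}$ with $f^{\{i\}}_{\{i,j\}}(p_i)=f^{\{j\}}_{\{i,j\}}(p_j)$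 for all $i,j<3$, there is $q\in X_\emptyset$ with $f^\emptyset_{\{i\}}(q)=p_i$ for all $i<3$. -}

module Defs where

open import Data.Nat using (ℕ; _≤_)
open import Data.Fin using (Fin)
open import Data.Fin.Subset using (Subset; _∩_; ⋂; ⋃; _⊆_; ⁅_⁆; _∪_; ⊥)
open import Data.Fin.Subset.Properties using (_∈?_; p∩q⊆q)
open import Data.Fin.Permutation using (Permutation′; _⟨$⟩ʳ_)
open import Data.List using (List; []; _∷_; map; filter; allFin)
open import Data.List.NonEmpty using (List⁺; toList) renaming (map to map⁺)
open import Data.List.Relation.Unary.Any using (Any)
open import Data.Vec using (Vec; lookup) renaming (map to vmap)
open import Data.Product using (Σ; _×_; proj₁; _,_)
open import Data.Unit using (⊤)
open import Relation.Binary.PropositionalEquality using (_≡_)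

b : {m : ℕ} → (Fin 3 → Subset m) → Subset 3 → Subset m
b a s with filter (_∈? s) (allFin 3)
... | []     = ⋃ (map a (allFin 3))
... | i ∷ is = ⋂ (map a (i ∷ is))

-- 2^p for p ⊆ Fin m: functions p → {0,1}, encoded as their support x ⊆ p.
Two : (m : ℕ) → Subset m → Set
Two m p = Σ (Subset m) (λ x → x ⊆ p)

_≈₂_ : {m : ℕ} {p : Subset m} → Two m p → Two m p → Set
x ≈₂ y = proj₁ x ≡ proj₁ y

res : {m : ℕ} {p : Subset m} (q : Subset m) → Two m p → Two m q
res q (x , _) = (x ∩ q , p∩q⊆q x q)

-- The functors Exp and SP^n on finite sets (sets given with an equality relation,
-- values in F(X) given with the induced equality of the quotient/hyperspace).
data Fun : Set where
  Exp : Fun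
  SP  : ℕ → Fun

Admissible : Fun → Set
Admissible Exp    = ⊤
Admissible (SP n) = 2 ≤ n

Obj : Fun → Set → Set
Obj Exp    A = List⁺ A      -- a nonempty subset, listed
Obj (SP n) A = Vec A n      -- a representative of X^n / Sym(n)

Eq : (F : Fun) {A : Set} → (A → A → Set) → Obj F A → Obj F A → Set
Eq Exp    _≈_ K L = (x : _) → ((Any (x ≈_) (toList K) → Any (x ≈_) (toList L))
                              × (Any (x ≈_) (toList L) → Any (x ≈_) (toList K)))
Eq (SP n) _≈_ v w = Σ (Permutation′ n) (λ σ → (i : Fin n) → lookup v (σ ⟨$⟩ʳ i) ≈ lookup w i)

fmap : (F : Fun) {A B : Set} → (A → B) → Obj F A → Obj F B
fmap Exp    f = map⁺ f
fmap (SP n) f = vmap f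

Cube : Fun → {m : ℕ} → (Fin 3 → Subset m) → Subset 3 → Set
Cube F {m} a s = Obj F (Two m (b a s))

cubeMap : (F : Fun) {m : ℕ} (a : Fin 3 → Subset m) (s t : Subset 3) → Cube F a s → Cube F a t
cubeMap F a s t = fmap F (res (b a t))

ThreeCommutative : (F : Fun) {m : ℕ} → (Fin 3 → Subset m) → Set
ThreeCommutative F a =
  (p : (i : Fin 3) → Cube F a ⁅ i ⁆) →
  ((i j : Fin 3) → Eq F _≈₂_ (cubeMap F a ⁅ i ⁆ (⁅ i ⁆ ∪ ⁅ j ⁆) (p i))
                             (cubeMap F a ⁅ j ⁆ (⁅ i ⁆ ∪ ⁅ j ⁆) (p j))) →
  Σ (Cube F a ⊥) (λ q → (i : Fin 3) → Eq F _≈₂_ (cubeMap F a ⊥ ⁅ i ⁆ q) (p i))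

-- Take aᵢ = 3 ∖ {i}: then 2^{b(∅)} = 2^3, 2^{aᵢ} records the two coordinates other than i,
-- and aᵢ ∩ aⱼ is the single remaining coordinate. Let pᵢ consist of a point of 2^{aᵢ} and its
-- complement (for SPⁿ padded with n − 2 copies of the empty point), so that any two of them
-- restrict to the same values {0, 1} on the shared coordinate: the triple is compatible.
-- Choose the points so that all members of p₀ and p₁ have equal coordinates, while p₂ contains
-- (y₀, y₁) = (1, 0). A lift would contain a y ∈ 2^3 restricting to that member of p₂ and to
-- members of p₀ and p₁, so y₀ = y₂ = y₁ and y₀ ≠ y₁.
module Submission where

open import Defs
open import Data.Bool using (true; _∧_)
open import Data.Bool.Properties using (∧-identityʳ)
open import Data.Nat using (ℕ; suc; s≤s)
open import Data.Fin using (Fin; zero; suc; #_)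
open import Data.Fin.Subset using (Subset; _∩_; _∪_; ⁅_⁆; ∁; ⊥)
open import Data.Fin.Subset.Properties using (p∩q⊆q)
open import Data.Fin.Permutation using (_⟨$⟩ʳ_; _⟨$⟩ˡ_; inverseʳ; flip; transpose)
import Data.Fin.Permutation as Permutation
open import Data.List using ([]; _∷_)
import Data.List.Membership.Propositional as List
import Data.List.Membership.Propositional.Properties as List
open import Data.List.NonEmpty using (toList; _∷_)
open import Data.List.Relation.Unary.Any using (Any; here; there)
open import Data.Vec using (_∷_; lookup; replicate) renaming (map to vmap)
import Data.Vec.Membership.Propositional as Vec
import Data.Vec.Membership.Propositional.Properties as Vec
import Data.Vec.Relation.Unary.Any as VecAny
import Data.Vec.Relation.Unary.Any.Properties as VecAny
open import Data.Vec.Properties using (lookup-map; lookup-replicate; lookup-zipWith)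
open import Data.Product using (Σ; ∃; _×_; _,_; proj₁; swap)
open import Function using (_∘_; _⇔_; mk⇔; Equivalence)
open import Level using (0ℓ)
open import Relation.Binary using (Rel; Reflexive; Symmetric; IsEquivalence)
open import Relation.Nullary using (¬_)
open import Relation.Unary using (Pred)
open import Relation.Binary.PropositionalEquality using (_≡_; refl; sym; trans; cong; subst; subst₂; module ≡-Reasoning)

infix 4 _∈⟨_⟩_

_∈⟨_⟩_ : {A : Set} → A → (F : Fun) → Obj F A → Set
x ∈⟨ Exp ⟩ K  = x List.∈ toList K
x ∈⟨ SP n ⟩ v = x Vec.∈ v

∈-fmap⁺ : ∀ F {A B : Set} (f : A → B) {x : A} {K : Obj F A} →
          x ∈⟨ F ⟩ K → f x ∈⟨ F ⟩ fmap F f K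
∈-fmap⁺ Exp    f = List.∈-map⁺ f
∈-fmap⁺ (SP n) f = Vec.∈-map⁺ f

∈-fmap⁻ : ∀ F {A B : Set} (f : A → B) {y : B} {K : Obj F A} →
          y ∈⟨ F ⟩ fmap F f K → ∃ λ x → x ∈⟨ F ⟩ K × y ≡ f x
∈-fmap⁻ Exp    f = List.∈-map⁻ f
∈-fmap⁻ (SP n) f = Vec.find ∘ VecAny.map⁻

module _ {A : Set} {_≈_ : Rel A 0ℓ} where

  Eq-sym : Symmetric _≈_ → ∀ F → Symmetric (Eq F _≈_)
  Eq-sym _     Exp    K≈L x = swap (K≈L x)
  Eq-sym ≈-sym (SP n) {v} {w} (σ , v≈w) = flip σ , λ i →
    ≈-sym (subst (λ j → lookup v j ≈ lookup w (σ ⟨$⟩ˡ i)) (inverseʳ σ) (v≈w (σ ⟨$⟩ˡ i)))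

  ∈-Eq : Reflexive _≈_ → ∀ F {K L : Obj F A} {x : A} →
         Eq F _≈_ K L → x ∈⟨ F ⟩ K → ∃ λ y → y ∈⟨ F ⟩ L × x ≈ y
  ∈-Eq ≈-refl Exp    K≈L x∈K = List.find (proj₁ (K≈L _) (List.lose x∈K ≈-refl))
  ∈-Eq ≈-refl (SP n) {v} {w} {x} (σ , v≈w) x∈v =
    lookup w i , Vec.∈-lookup i w , subst (_≈ lookup w i) (sym x≡vσi) (v≈w i)
    where
    i : Fin n
    i = σ ⟨$⟩ˡ VecAny.index x∈v
    x≡vσi : x ≡ lookup v (σ ⟨$⟩ʳ i)
    x≡vσi = trans (VecAny.lookup-index x∈v) (cong (lookup v) (sym (inverseʳ σ)))

module _ {A B : Set} {_≈_ : Rel B 0ℓ} (≈-refl : Reflexive _≈_) (F : Fun) (f : A → B)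
         {K : Obj F A} {L : Obj F B} (fK≈L : Eq F _≈_ (fmap F f K) L) where

  ∈-Eq-image : ∀ {x} → x ∈⟨ F ⟩ K → ∃ λ y → y ∈⟨ F ⟩ L × f x ≈ y
  ∈-Eq-image x∈K = ∈-Eq ≈-refl F fK≈L (∈-fmap⁺ F f x∈K)

  ∈-Eq-preimage : Symmetric _≈_ → ∀ {y} → y ∈⟨ F ⟩ L → ∃ λ x → x ∈⟨ F ⟩ K × y ≈ f x
  ∈-Eq-preimage ≈-sym y∈L with ∈-Eq ≈-refl F (Eq-sym ≈-sym F fK≈L) y∈L
  ... | z , z∈fK , y≈z with ∈-fmap⁻ F f z∈fK
  ... | x , x∈K , refl = x , x∈K , y≈z

Lift : (F : Fun) {m : ℕ} (a : Fin 3 → Subset m) → ((i : Fin 3) → Cube F a ⁅ i ⁆) → Cube F a ⊥ → Set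
Lift F a p q = (i : Fin 3) → Eq F _≈₂_ (cubeMap F a ⊥ ⁅ i ⁆ q) (p i)

lift-member : ∀ F {m} {a : Fin 3 → Subset m} {p q} → Lift F a p q →
              ∀ {k x} → x ∈⟨ F ⟩ p k →
              ∃ λ y → x ≈₂ res (b a ⁅ k ⁆) y ×
                      ((i : Fin 3) → ∃ λ x′ → x′ ∈⟨ F ⟩ p i × res (b a ⁅ i ⁆) y ≈₂ x′)
lift-member F {a = a} q-lifts {k} x∈pk
  with ∈-Eq-preimage refl F (res (b a ⁅ k ⁆)) (q-lifts k) sym x∈pk
... | y , y∈q , x≈y = y , x≈y , λ i → ∈-Eq-image refl F (res (b a ⁅ i ⁆)) (q-lifts i) y∈q

pair : (F : Fun) → Admissible F → {A : Set} → A → A → A → Obj F A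
pair Exp                _ u w _ = u ∷ w ∷ []
pair (SP (suc (suc k))) _ u w c = u ∷ w ∷ replicate k c
pair (SP 1)             (s≤s ())

pair-All : ∀ F ok {A : Set} {P : Pred A 0ℓ} {u w c} → P u → P w → P c →
           ∀ {x} → x ∈⟨ F ⟩ pair F ok u w c → P x
pair-All Exp                _ Pu Pw Pc (here refl)         = Pu
pair-All Exp                _ Pu Pw Pc (there (here refl)) = Pw
pair-All (SP (suc (suc k))) _ Pu Pw Pc (VecAny.here refl)         = Pu
pair-All (SP (suc (suc k))) _ Pu Pw Pc (VecAny.there (VecAny.here refl)) = Pw
pair-All (SP (suc (suc k))) _ {P = P} Pu Pw Pc (VecAny.there (VecAny.there x∈cs)) =
  subst P (trans (sym (lookup-replicate (VecAny.index x∈cs) _)) (sym (VecAny.lookup-index x∈cs))) Pc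
pair-All (SP 1)             (s≤s ())

pair-first : ∀ F ok {A : Set} {u w c : A} → u ∈⟨ F ⟩ pair F ok u w c
pair-first Exp                _ = here refl
pair-first (SP (suc (suc k))) _ = VecAny.here refl
pair-first (SP 1)             (s≤s ())

module _ {A A′ B : Set} {_≈_ : Rel B 0ℓ} (≈-equiv : IsEquivalence _≈_) (f : A → B) (g : A′ → B)
         {u w c : A} {u′ w′ c′ : A′} (u≈u′ : f u ≈ g u′) (w≈w′ : f w ≈ g w′) (c≈c′ : f c ≈ g c′) where

  open IsEquivalence ≈-equiv using () renaming (sym to ≈-sym; trans to ≈-trans)

  private
    padding-cong : ∀ {k} (j : Fin k) → lookup (vmap f (replicate k c)) j ≈ lookup (vmap g (replicate k c′)) j
    padding-cong {k} j =
      subst₂ _≈_ (sym (lookup-map-replicate f c)) (sym (lookup-map-replicate g c′)) c≈c′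
      where
      lookup-map-replicate : ∀ {X : Set} (h : X → B) (d : X) → lookup (vmap h (replicate k d)) j ≡ h d
      lookup-map-replicate h d = trans (lookup-map j h (replicate k d)) (cong h (lookup-replicate j d))

  pair-cong : ∀ F ok → Eq F _≈_ (fmap F f (pair F ok u w c)) (fmap F g (pair F ok u′ w′ c′))
  pair-cong Exp _ x = to , from
    where
    to : Any (x ≈_) (f u ∷ f w ∷ []) → Any (x ≈_) (g u′ ∷ g w′ ∷ [])
    to (here e)         = here (≈-trans e u≈u′)
    to (there (here e)) = there (here (≈-trans e w≈w′))
    from : Any (x ≈_) (g u′ ∷ g w′ ∷ []) → Any (x ≈_) (f u ∷ f w ∷ [])
    from (here e)         = here (≈-trans e (≈-sym u≈u′))
    from (there (here e)) = there (here (≈-trans e (≈-sym w≈w′)))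
  pair-cong (SP (suc (suc k))) _ = Permutation.id , λ
    { zero → u≈u′ ; (suc zero) → w≈w′ ; (suc (suc j)) → padding-cong j }
  pair-cong (SP 1) (s≤s ())

  pair-swap-cong : ∀ F ok → Eq F _≈_ (fmap F f (pair F ok u w c)) (fmap F g (pair F ok w′ u′ c′))
  pair-swap-cong Exp _ x = to , from
    where
    to : Any (x ≈_) (f u ∷ f w ∷ []) → Any (x ≈_) (g w′ ∷ g u′ ∷ [])
    to (here e)         = there (here (≈-trans e u≈u′))
    to (there (here e)) = here (≈-trans e w≈w′)
    from : Any (x ≈_) (g w′ ∷ g u′ ∷ []) → Any (x ≈_) (f u ∷ f w ∷ [])
    from (here e)         = there (here (≈-trans e (≈-sym w≈w′)))
    from (there (here e)) = here (≈-trans e (≈-sym u≈u′))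
  pair-swap-cong (SP (suc (suc k))) _ = transpose zero (suc zero) , λ
    { zero → w≈w′ ; (suc zero) → u≈u′ ; (suc (suc j)) → padding-cong j }
  pair-swap-cong (SP 1) (s≤s ())

≈₂-isEquivalence : ∀ {m} {p : Subset m} → IsEquivalence (_≈₂_ {m} {p})
≈₂-isEquivalence = record { refl = refl ; sym = sym ; trans = trans }

omit : Fin 3 → Subset 3
omit i = ∁ ⁅ i ⁆

point : ∀ {m} (p : Subset m) → Subset m → Two m p
point p x = x ∩ p , p∩q⊆q x p

seed : Fin 3 → Subset 3
seed (suc (suc zero)) = ⁅ zero ⁆
seed _                = ⊥

parityTriple : (F : Fun) → Admissible F → (i : Fin 3) → Cube F omit ⁅ i ⁆
parityTriple F ok i = pair F ok (point _ (seed i)) (point _ (∁ (seed i))) (point _ ⊥)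

-- On the shared coordinate both sides restrict to {0, 1}; only for the pair {1, 2}
-- does the order of the two points differ.
parityTriple-compatible : ∀ F ok (i j : Fin 3) →
  Eq F _≈₂_ (cubeMap F omit ⁅ i ⁆ (⁅ i ⁆ ∪ ⁅ j ⁆) (parityTriple F ok i))
            (cubeMap F omit ⁅ j ⁆ (⁅ i ⁆ ∪ ⁅ j ⁆) (parityTriple F ok j))
parityTriple-compatible F ok zero             zero             = pair-cong      ≈₂-isEquivalence _ _ refl refl refl F ok
parityTriple-compatible F ok zero             (suc zero)       = pair-cong      ≈₂-isEquivalence _ _ refl refl refl F ok
parityTriple-compatible F ok zero             (suc (suc zero)) = pair-cong      ≈₂-isEquivalence _ _ refl refl refl F ok
parityTriple-compatible F ok (suc zero)       zero             = pair-cong      ≈₂-isEquivalence _ _ refl refl refl F ok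
parityTriple-compatible F ok (suc zero)       (suc zero)       = pair-cong      ≈₂-isEquivalence _ _ refl refl refl F ok
parityTriple-compatible F ok (suc zero)       (suc (suc zero)) = pair-swap-cong ≈₂-isEquivalence _ _ refl refl refl F ok
parityTriple-compatible F ok (suc (suc zero)) zero             = pair-cong      ≈₂-isEquivalence _ _ refl refl refl F ok
parityTriple-compatible F ok (suc (suc zero)) (suc zero)       = pair-swap-cong ≈₂-isEquivalence _ _ refl refl refl F ok
parityTriple-compatible F ok (suc (suc zero)) (suc (suc zero)) = pair-cong      ≈₂-isEquivalence _ _ refl refl refl F ok

Agree : ∀ {m} → Fin m → Fin m → Subset m → Set
Agree j k x = lookup x j ≡ lookup x k

lookup-∩-inside : ∀ {m} (x : Subset m) {p : Subset m} {j} → lookup p j ≡ true → lookup (x ∩ p) j ≡ lookup x j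
lookup-∩-inside x {p} {j} p∋j = begin
  lookup (x ∩ p) j         ≡⟨ lookup-zipWith _∧_ j x p ⟩
  lookup x j ∧ lookup p j  ≡⟨ cong (lookup x j ∧_) p∋j ⟩
  lookup x j ∧ true        ≡⟨ ∧-identityʳ _ ⟩
  lookup x j               ∎
  where open ≡-Reasoning

Agree-restriction : ∀ {m} {p x y : Subset m} {j k} → lookup p j ≡ true → lookup p k ≡ true →
                    x ∩ p ≡ y → Agree j k x ⇔ Agree j k y
Agree-restriction {x = x} p∋j p∋k refl = mk⇔
  (λ e → trans (lookup-∩-inside x p∋j) (trans e (sym (lookup-∩-inside x p∋k))))
  (λ e → trans (sym (lookup-∩-inside x p∋j)) (trans e (lookup-∩-inside x p∋k)))

parityTriple-agree₀ : ∀ F ok {x} → x ∈⟨ F ⟩ parityTriple F ok (# 0) → Agree (# 1) (# 2) (proj₁ x)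
parityTriple-agree₀ F ok = pair-All F ok {P = Agree (# 1) (# 2) ∘ proj₁} refl refl refl

parityTriple-agree₁ : ∀ F ok {x} → x ∈⟨ F ⟩ parityTriple F ok (# 1) → Agree (# 0) (# 2) (proj₁ x)
parityTriple-agree₁ F ok = pair-All F ok {P = Agree (# 0) (# 2) ∘ proj₁} refl refl refl

seed₂-disagrees : ¬ Agree (# 0) (# 1) (proj₁ (point (b omit ⁅ # 2 ⁆) (seed (# 2))))
seed₂-disagrees ()

corollary6p20 : (F : Fun) → Admissible F →
    Σ ℕ (λ m → Σ (Fin 3 → Subset m) (λ a → ¬ ThreeCommutative F a))
corollary6p20 F ok = 3 , omit , not-3-commutative
  where
  not-3-commutative : ¬ ThreeCommutative F omit
  not-3-commutative tc with tc (parityTriple F ok) (parityTriple-compatible F ok)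
  ... | q , q-lifts with lift-member F q-lifts {k = # 2} (pair-first F ok)
  ... | y , seed≈y , restricts-into with restricts-into (# 0) | restricts-into (# 1)
  ... | x₀ , x₀∈p₀ , y≈x₀ | x₁ , x₁∈p₁ , y≈x₁ =
    seed₂-disagrees (Equivalence.to (Agree-restriction refl refl (sym seed≈y)) (trans y₀₂ (sym y₁₂)))
    where
    y₁₂ : Agree (# 1) (# 2) (proj₁ y)
    y₁₂ = Equivalence.from (Agree-restriction refl refl y≈x₀) (parityTriple-agree₀ F ok x₀∈p₀)
    y₀₂ : Agree (# 0) (# 2) (proj₁ y)
    y₀₂ = Equivalence.from (Agree-restriction refl refl y≈x₁) (parityTriple-agree₁ F ok x₁∈p₁)
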